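{- Define integers $B_3(n,k,l)$, for $n\ge 1$ and $k,l\ge 0$, by: $B_3(1,0,0)=1$; for $n>1$ and $k+l<n$, $B_3(n,k,l)=\sum_{0\le i\le k,\ 0\le j\le l} B_3(n-1,i,j)$; and $B_3(n,k,l)=0$ whenever $k+l\ge n$. Then for all integers $n\ge 1$, $k,l\ge 0$ with $k+l<n$, $$B_3(n,k,l)=\binom{n+k}{k}\binom{n+l-1}{l}\frac{n-k-l}{n+k}.$$ -}

module Defs where

open import Data.Nat using (ℕ; zero; suc; _+_; _<?_)
open import Data.List using (map; upTo)
open import Data.Nat.ListAction using (sum)
open import Relation.Nullary.Decidable using (does)
open import Data.Bool using (if_then_else_)

Σ≤ : ℕ → (ℕ → ℕ) → ℕ
Σ≤ k f = sum (map f (upTo (suc k)))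

-- B₃' m k l  represents  B₃(m+1, k, l)  (so that the index n = m+1 ≥ 1).
B₃' : ℕ → ℕ → ℕ → ℕ
B₃' zero zero zero = 1
B₃' zero _ _ = 0                       -- k + l ≥ 1 = n
B₃' (suc m) k l =
  if does (k + l <? suc (suc m))
  then Σ≤ k (λ i → Σ≤ l (λ j → B₃' m i j))
  else 0

-- B₃ n k l for n ≥ 1 (value at n = 0 is an irrelevant default 0).
B₃ : ℕ → ℕ → ℕ → ℕ
B₃ zero _ _ = 0
B₃ (suc m) k l = B₃' m k l

-- Write n = m + 1, C⁺ i = C(m+i, i) and C⁻ i = C(m+i, i-1) = i C⁺ i / (m+1).  For i + j ≤ m + 1
--
--   B₃(n, i, j) = C⁺ i C⁺ j − Δ i j,   where  Δ i j = C⁻ i C⁺ j + C⁺ i C⁻ j,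
--
-- and the right-hand side is (m + 1 − i − j) C⁺ i C⁺ j / (m + 1).  On the line i + j = m + 1 both
-- sides vanish; inside it, the double partial sums over i' ≤ i, j' ≤ j that define B₃(n + 1, i, j)
-- carry the right-hand side at level m to the one at level m + 1, because C⁺ and C⁻ each sum
-- (hockey stick) to their counterpart at m + 1.  The induction on m is run on the
-- subtraction-free form B₃ + Δ = C⁺ C⁺.
module Submission where

open import Defs
open import Data.Nat using (ℕ; zero; suc; _+_; _*_; _∸_; _≤_; _<_; s≤s; z≤n; _<?_)
open import Data.Nat.Properties
open import Data.Nat.Combinatorics using (_C_; nCk+nC[k+1]≡[n+1]C[k+1]; nCk≡nC[n∸k]; nC1≡n; nCn≡1)
open import Data.Nat.ListAction using (sum)
open import Data.Nat.ListAction.Properties using (sum-++)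
open import Data.Nat.Tactic.RingSolver using (solve-∀)
open import Data.List using ([]; _∷_; _++_; map; upTo)
open import Data.List.Properties using (map-cong; map-++; upTo-∷ʳ)
open import Data.Sum using (inj₁; inj₂)
open import Relation.Binary.PropositionalEquality using (_≡_; refl; sym; trans; cong; cong₂; module ≡-Reasoning)
open import Relation.Nullary.Decidable using (dec-true; dec-false)
open import Algebra.Properties.CommutativeSemigroup +-commutativeSemigroup using (interchange)

open ≡-Reasoning

sum-map-+ : ∀ {A : Set} (f g : A → ℕ) xs →
            sum (map (λ x → f x + g x) xs) ≡ sum (map f xs) + sum (map g xs)
sum-map-+ f g []       = refl
sum-map-+ f g (x ∷ xs) = trans (cong (f x + g x +_) (sum-map-+ f g xs)) (interchange (f x) (g x) _ _)

sum-map-*ˡ : ∀ {A : Set} c (f : A → ℕ) xs → sum (map (λ x → c * f x) xs) ≡ c * sum (map f xs)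
sum-map-*ˡ c f []       = sym (*-zeroʳ c)
sum-map-*ˡ c f (x ∷ xs) = trans (cong (c * f x +_) (sum-map-*ˡ c f xs)) (sym (*-distribˡ-+ c (f x) _))

sum-map-*ʳ : ∀ {A : Set} c (f : A → ℕ) xs → sum (map (λ x → f x * c) xs) ≡ sum (map f xs) * c
sum-map-*ʳ c f []       = refl
sum-map-*ʳ c f (x ∷ xs) = trans (cong (f x * c +_) (sum-map-*ʳ c f xs)) (sym (*-distribʳ-+ c (f x) _))

sum-map-sum-map-* : ∀ {A B : Set} (f : A → ℕ) (g : B → ℕ) xs ys →
                    sum (map (λ x → sum (map (λ y → f x * g y) ys)) xs) ≡ sum (map f xs) * sum (map g ys)
sum-map-sum-map-* f g xs ys = begin
  sum (map (λ x → sum (map (λ y → f x * g y) ys)) xs) ≡⟨ cong sum (map-cong (λ x → sum-map-*ˡ (f x) g ys) xs) ⟩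
  sum (map (λ x → f x * sum (map g ys)) xs)           ≡⟨ sum-map-*ʳ (sum (map g ys)) f xs ⟩
  sum (map f xs) * sum (map g ys)                     ∎

Σ≤-suc : ∀ k f → Σ≤ (suc k) f ≡ Σ≤ k f + f (suc k)
Σ≤-suc k f = begin
  sum (map f (upTo (suc (suc k))))             ≡⟨ cong (λ xs → sum (map f xs)) (upTo-∷ʳ (suc k)) ⟨
  sum (map f (upTo (suc k) ++ suc k ∷ []))     ≡⟨ cong sum (map-++ f (upTo (suc k)) (suc k ∷ [])) ⟩
  sum (map f (upTo (suc k)) ++ f (suc k) ∷ []) ≡⟨ sum-++ (map f (upTo (suc k))) (f (suc k) ∷ []) ⟩
  Σ≤ k f + (f (suc k) + 0)                     ≡⟨ cong (Σ≤ k f +_) (+-identityʳ (f (suc k))) ⟩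
  Σ≤ k f + f (suc k)                           ∎

Σ≤-cong : ∀ k {f g : ℕ → ℕ} → (∀ {i} → i ≤ k → f i ≡ g i) → Σ≤ k f ≡ Σ≤ k g
Σ≤-cong zero    f≡g = cong (_+ 0) (f≡g z≤n)
Σ≤-cong (suc k) {f} {g} f≡g = begin
  Σ≤ (suc k) f       ≡⟨ Σ≤-suc k f ⟩
  Σ≤ k f + f (suc k) ≡⟨ cong₂ _+_ (Σ≤-cong k (λ i≤k → f≡g (m≤n⇒m≤1+n i≤k))) (f≡g ≤-refl) ⟩
  Σ≤ k g + g (suc k) ≡⟨ Σ≤-suc k g ⟨
  Σ≤ (suc k) g       ∎

Σ≤² : ℕ → ℕ → (ℕ → ℕ → ℕ) → ℕ
Σ≤² k l f = Σ≤ k (λ i → Σ≤ l (f i))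

Σ≤²-cong : ∀ k l {f g : ℕ → ℕ → ℕ} → (∀ {i j} → i ≤ k → j ≤ l → f i j ≡ g i j) →
           Σ≤² k l f ≡ Σ≤² k l g
Σ≤²-cong k l f≡g = Σ≤-cong k (λ i≤k → Σ≤-cong l (f≡g i≤k))

Σ≤²-+ : ∀ k l (f g : ℕ → ℕ → ℕ) → Σ≤² k l (λ i j → f i j + g i j) ≡ Σ≤² k l f + Σ≤² k l g
Σ≤²-+ k l f g = begin
  Σ≤² k l (λ i j → f i j + g i j)          ≡⟨ cong sum (map-cong (λ i → sum-map-+ (f i) (g i) (upTo (suc l))) (upTo (suc k))) ⟩
  Σ≤ k (λ i → Σ≤ l (f i) + Σ≤ l (g i))     ≡⟨ sum-map-+ (λ i → Σ≤ l (f i)) (λ i → Σ≤ l (g i)) (upTo (suc k)) ⟩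
  Σ≤² k l f + Σ≤² k l g                    ∎

Σ≤²-* : ∀ k l (f g : ℕ → ℕ) → Σ≤² k l (λ i j → f i * g j) ≡ Σ≤ k f * Σ≤ l g
Σ≤²-* k l f g = sum-map-sum-map-* f g (upTo (suc k)) (upTo (suc l))

C⁺ : ℕ → ℕ → ℕ
C⁺ m i = (m + i) C i

-- Not (m + i) C (i ∸ 1), which would be 1 rather than 0 at i = 0.
C⁻ : ℕ → ℕ → ℕ
C⁻ m zero    = 0
C⁻ m (suc i) = C⁺ (suc m) i

C⁺-pascal : ∀ m i → C⁺ (suc m) (suc i) ≡ C⁺ (suc m) i + C⁺ m (suc i)
C⁺-pascal m i = begin
  suc (m + suc i) C suc i                  ≡⟨ nCk+nC[k+1]≡[n+1]C[k+1] (m + suc i) i ⟨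
  (m + suc i) C i + (m + suc i) C suc i    ≡⟨ cong (λ n → n C i + (m + suc i) C suc i) (+-suc m i) ⟩
  C⁺ (suc m) i + C⁺ m (suc i)              ∎

C⁺[1,i]≡1+i : ∀ i → C⁺ 1 i ≡ suc i
C⁺[1,i]≡1+i i = begin
  suc i C i           ≡⟨ nCk≡nC[n∸k] (n≤1+n i) ⟩
  suc i C (1 + i ∸ i) ≡⟨ cong (suc i C_) (m+n∸n≡m 1 i) ⟩
  suc i C 1           ≡⟨ nC1≡n (suc i) ⟩
  suc i               ∎

Σ≤-C⁺ : ∀ m k → Σ≤ k (C⁺ m) ≡ C⁺ (suc m) k
Σ≤-C⁺ m zero    = refl
Σ≤-C⁺ m (suc k) = begin
  Σ≤ (suc k) (C⁺ m)              ≡⟨ Σ≤-suc k (C⁺ m) ⟩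
  Σ≤ k (C⁺ m) + C⁺ m (suc k)     ≡⟨ cong (_+ C⁺ m (suc k)) (Σ≤-C⁺ m k) ⟩
  C⁺ (suc m) k + C⁺ m (suc k)    ≡⟨ C⁺-pascal m k ⟨
  C⁺ (suc m) (suc k)             ∎

Σ≤-C⁻ : ∀ m k → Σ≤ k (C⁻ m) ≡ C⁻ (suc m) k
Σ≤-C⁻ m zero    = refl
Σ≤-C⁻ m (suc k) = begin
  Σ≤ (suc k) (C⁻ m)              ≡⟨ Σ≤-suc k (C⁻ m) ⟩
  Σ≤ k (C⁻ m) + C⁺ (suc m) k     ≡⟨ cong (_+ C⁺ (suc m) k) (Σ≤-C⁻ m k) ⟩
  C⁻ (suc m) k + C⁺ (suc m) k    ≡⟨ pascal k ⟩
  C⁺ (suc (suc m)) k             ∎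
  where
  pascal : ∀ k → C⁻ (suc m) k + C⁺ (suc m) k ≡ C⁺ (suc (suc m)) k
  pascal zero    = refl
  pascal (suc k) = sym (C⁺-pascal (suc m) k)

[1+m]*C⁺[1+m,i]≡[1+i]*C⁺[m,1+i] : ∀ m i → suc m * C⁺ (suc m) i ≡ suc i * C⁺ m (suc i)
[1+m]*C⁺[1+m,i]≡[1+i]*C⁺[m,1+i] zero i = begin
  1 * C⁺ 1 i             ≡⟨ *-identityˡ (C⁺ 1 i) ⟩
  C⁺ 1 i                 ≡⟨ C⁺[1,i]≡1+i i ⟩
  suc i                  ≡⟨ *-identityʳ (suc i) ⟨
  suc i * 1              ≡⟨ cong (suc i *_) (nCn≡1 (suc i)) ⟨
  suc i * C⁺ 0 (suc i)   ∎
[1+m]*C⁺[1+m,i]≡[1+i]*C⁺[m,1+i] (suc m) zero = begin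
  suc (suc m) * 1        ≡⟨ *-identityʳ (suc (suc m)) ⟩
  suc (suc m)            ≡⟨ +-comm 1 (suc m) ⟩
  suc m + 1              ≡⟨ nC1≡n (suc m + 1) ⟨
  C⁺ (suc m) 1           ≡⟨ *-identityˡ (C⁺ (suc m) 1) ⟨
  1 * C⁺ (suc m) 1       ∎
[1+m]*C⁺[1+m,i]≡[1+i]*C⁺[m,1+i] (suc m) (suc i) = begin
  suc (suc m) * C⁺ (suc (suc m)) (suc i)
    ≡⟨ cong (suc (suc m) *_) (C⁺-pascal (suc m) i) ⟩
  suc (suc m) * (C⁺ (suc (suc m)) i + X)
    ≡⟨ *-distribˡ-+ (suc (suc m)) (C⁺ (suc (suc m)) i) X ⟩
  suc (suc m) * C⁺ (suc (suc m)) i + suc (suc m) * X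
    ≡⟨ cong (_+ suc (suc m) * X) ([1+m]*C⁺[1+m,i]≡[1+i]*C⁺[m,1+i] (suc m) i) ⟩
  suc i * X + suc (suc m) * X
    ≡⟨ shift i m X ⟩
  suc (suc i) * X + suc m * C⁺ (suc m) (suc i)
    ≡⟨ cong (suc (suc i) * X +_) ([1+m]*C⁺[1+m,i]≡[1+i]*C⁺[m,1+i] m (suc i)) ⟩
  suc (suc i) * X + suc (suc i) * C⁺ m (suc (suc i))
    ≡⟨ *-distribˡ-+ (suc (suc i)) X (C⁺ m (suc (suc i))) ⟨
  suc (suc i) * (X + C⁺ m (suc (suc i)))
    ≡⟨ cong (suc (suc i) *_) (C⁺-pascal m (suc i)) ⟨
  suc (suc i) * C⁺ (suc m) (suc (suc i))
    ∎
  where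
  X = C⁺ (suc m) (suc i)
  shift : ∀ i m x → suc i * x + suc (suc m) * x ≡ suc (suc i) * x + suc m * x
  shift = solve-∀

[1+m]*C⁺[1+m,k]≡[1+m+k]*C⁺[m,k] : ∀ m k → suc m * C⁺ (suc m) k ≡ (suc m + k) * C⁺ m k
[1+m]*C⁺[1+m,k]≡[1+m+k]*C⁺[m,k] m zero = cong (_* 1) (sym (+-identityʳ (suc m)))
[1+m]*C⁺[1+m,k]≡[1+m+k]*C⁺[m,k] m (suc k) = begin
  suc m * C⁺ (suc m) (suc k)                    ≡⟨ cong (suc m *_) (C⁺-pascal m k) ⟩
  suc m * (C⁺ (suc m) k + X)                    ≡⟨ *-distribˡ-+ (suc m) (C⁺ (suc m) k) X ⟩
  suc m * C⁺ (suc m) k + suc m * X              ≡⟨ cong (_+ suc m * X) ([1+m]*C⁺[1+m,i]≡[1+i]*C⁺[m,1+i] m k) ⟩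
  suc k * X + suc m * X                         ≡⟨ *-distribʳ-+ X (suc k) (suc m) ⟨
  (suc k + suc m) * X                           ≡⟨ cong (_* X) (+-comm (suc k) (suc m)) ⟩
  (suc m + suc k) * X                           ∎
  where X = C⁺ m (suc k)

[1+m]*C⁻[m,i]≡i*C⁺[m,i] : ∀ m i → suc m * C⁻ m i ≡ i * C⁺ m i
[1+m]*C⁻[m,i]≡i*C⁺[m,i] m zero    = *-zeroʳ (suc m)
[1+m]*C⁻[m,i]≡i*C⁺[m,i] m (suc i) = [1+m]*C⁺[1+m,i]≡[1+i]*C⁺[m,1+i] m i

B₃'-vanishes : ∀ m {k l} → suc m ≤ k + l → B₃' m k l ≡ 0
B₃'-vanishes zero    {zero}  {zero}  ()
B₃'-vanishes zero    {zero}  {suc l} _ = refl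
B₃'-vanishes zero    {suc k}         _ = refl
B₃'-vanishes (suc m) {k}     {l}     2+m≤k+l
  rewrite dec-false (k + l <? suc (suc m)) (λ k+l<2+m → <⇒≱ k+l<2+m 2+m≤k+l) = refl

B₃'-suc : ∀ m {k l} → k + l ≤ suc m → B₃' (suc m) k l ≡ Σ≤² k l (B₃' m)
B₃'-suc m {k} {l} k+l≤1+m rewrite dec-true (k + l <? suc (suc m)) (s≤s k+l≤1+m) = refl

Δ : ℕ → ℕ → ℕ → ℕ
Δ m i j = C⁻ m i * C⁺ m j + C⁺ m i * C⁻ m j

[1+m]*Δ≡[i+j]*C⁺*C⁺ : ∀ m i j → suc m * Δ m i j ≡ (i + j) * (C⁺ m i * C⁺ m j)
[1+m]*Δ≡[i+j]*C⁺*C⁺ m i j = begin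
  suc m * (C⁻ m i * C⁺ m j + C⁺ m i * C⁻ m j)
    ≡⟨ distribute (suc m) (C⁻ m i) (C⁺ m j) (C⁺ m i) (C⁻ m j) ⟩
  suc m * C⁻ m i * C⁺ m j + C⁺ m i * (suc m * C⁻ m j)
    ≡⟨ cong₂ (λ x y → x * C⁺ m j + C⁺ m i * y) ([1+m]*C⁻[m,i]≡i*C⁺[m,i] m i) ([1+m]*C⁻[m,i]≡i*C⁺[m,i] m j) ⟩
  i * C⁺ m i * C⁺ m j + C⁺ m i * (j * C⁺ m j)
    ≡⟨ collect i j (C⁺ m i) (C⁺ m j) ⟩
  (i + j) * (C⁺ m i * C⁺ m j)
    ∎
  where
  distribute : ∀ s a b c d → s * (a * b + c * d) ≡ s * a * b + c * (s * d)
  distribute = solve-∀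
  collect : ∀ i j a b → i * a * b + a * (j * b) ≡ (i + j) * (a * b)
  collect = solve-∀

Δ-boundary : ∀ m i j → i + j ≡ suc m → Δ m i j ≡ C⁺ m i * C⁺ m j
Δ-boundary m i j i+j≡1+m = *-cancelˡ-≡ (Δ m i j) _ (suc m)
  (trans ([1+m]*Δ≡[i+j]*C⁺*C⁺ m i j) (cong (_* (C⁺ m i * C⁺ m j)) i+j≡1+m))

Σ≤²-C⁺*C⁺ : ∀ m k l → Σ≤² k l (λ i j → C⁺ m i * C⁺ m j) ≡ C⁺ (suc m) k * C⁺ (suc m) l
Σ≤²-C⁺*C⁺ m k l = trans (Σ≤²-* k l (C⁺ m) (C⁺ m)) (cong₂ _*_ (Σ≤-C⁺ m k) (Σ≤-C⁺ m l))

Σ≤²-Δ : ∀ m k l → Σ≤² k l (Δ m) ≡ Δ (suc m) k l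
Σ≤²-Δ m k l = begin
  Σ≤² k l (Δ m)
    ≡⟨ Σ≤²-+ k l (λ i j → C⁻ m i * C⁺ m j) (λ i j → C⁺ m i * C⁻ m j) ⟩
  Σ≤² k l (λ i j → C⁻ m i * C⁺ m j) + Σ≤² k l (λ i j → C⁺ m i * C⁻ m j)
    ≡⟨ cong₂ _+_ (Σ≤²-* k l (C⁻ m) (C⁺ m)) (Σ≤²-* k l (C⁺ m) (C⁻ m)) ⟩
  Σ≤ k (C⁻ m) * Σ≤ l (C⁺ m) + Σ≤ k (C⁺ m) * Σ≤ l (C⁻ m)
    ≡⟨ cong₂ _+_ (cong₂ _*_ (Σ≤-C⁻ m k) (Σ≤-C⁺ m l)) (cong₂ _*_ (Σ≤-C⁺ m k) (Σ≤-C⁻ m l)) ⟩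
  Δ (suc m) k l
    ∎

B₃'+Δ≡C⁺*C⁺ : ∀ m {i j} → i + j ≤ suc m → B₃' m i j + Δ m i j ≡ C⁺ m i * C⁺ m j

B₃'+Δ≡C⁺*C⁺-interior : ∀ m {i j} → i + j ≤ m → B₃' m i j + Δ m i j ≡ C⁺ m i * C⁺ m j
B₃'+Δ≡C⁺*C⁺-interior zero    {zero}  {zero}  z≤n = refl
B₃'+Δ≡C⁺*C⁺-interior zero    {zero}  {suc j} ()
B₃'+Δ≡C⁺*C⁺-interior zero    {suc i}         ()
B₃'+Δ≡C⁺*C⁺-interior (suc m) {k}     {l}     k+l≤1+m = begin
  B₃' (suc m) k l + Δ (suc m) k l
    ≡⟨ cong₂ _+_ (B₃'-suc m {k} {l} k+l≤1+m) (sym (Σ≤²-Δ m k l)) ⟩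
  Σ≤² k l (B₃' m) + Σ≤² k l (Δ m)
    ≡⟨ Σ≤²-+ k l (B₃' m) (Δ m) ⟨
  Σ≤² k l (λ i j → B₃' m i j + Δ m i j)
    ≡⟨ Σ≤²-cong k l (λ i≤k j≤l → B₃'+Δ≡C⁺*C⁺ m (≤-trans (+-mono-≤ i≤k j≤l) k+l≤1+m)) ⟩
  Σ≤² k l (λ i j → C⁺ m i * C⁺ m j)
    ≡⟨ Σ≤²-C⁺*C⁺ m k l ⟩
  C⁺ (suc m) k * C⁺ (suc m) l
    ∎

B₃'+Δ≡C⁺*C⁺ m {i} {j} i+j≤1+m with m≤n⇒m<n∨m≡n i+j≤1+m
... | inj₁ (s≤s i+j≤m) = B₃'+Δ≡C⁺*C⁺-interior m i+j≤m
... | inj₂ i+j≡1+m     = begin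
  B₃' m i j + Δ m i j ≡⟨ cong (_+ Δ m i j) (B₃'-vanishes m (≤-reflexive (sym i+j≡1+m))) ⟩
  Δ m i j             ≡⟨ Δ-boundary m i j i+j≡1+m ⟩
  C⁺ m i * C⁺ m j     ∎

[1+m]*B₃'≡[1+m-k-l]*C⁺*C⁺ : ∀ m {k l} → k + l ≤ suc m →
                            suc m * B₃' m k l ≡ (suc m ∸ k ∸ l) * (C⁺ m k * C⁺ m l)
[1+m]*B₃'≡[1+m-k-l]*C⁺*C⁺ m {k} {l} k+l≤1+m = +-cancelʳ-≡ ((k + l) * PQ) _ _ (begin
  suc m * B₃' m k l + (k + l) * PQ
    ≡⟨ cong (suc m * B₃' m k l +_) ([1+m]*Δ≡[i+j]*C⁺*C⁺ m k l) ⟨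
  suc m * B₃' m k l + suc m * Δ m k l
    ≡⟨ *-distribˡ-+ (suc m) (B₃' m k l) (Δ m k l) ⟨
  suc m * (B₃' m k l + Δ m k l)
    ≡⟨ cong (suc m *_) (B₃'+Δ≡C⁺*C⁺ m k+l≤1+m) ⟩
  suc m * PQ
    ≡⟨ cong (_* PQ) c+[k+l]≡1+m ⟨
  (c + (k + l)) * PQ
    ≡⟨ *-distribʳ-+ PQ c (k + l) ⟩
  c * PQ + (k + l) * PQ
    ∎)
  where
  PQ = C⁺ m k * C⁺ m l
  c  = suc m ∸ k ∸ l
  c+[k+l]≡1+m : c + (k + l) ≡ suc m
  c+[k+l]≡1+m = trans (cong (_+ (k + l)) (∸-+-assoc (suc m) k l)) (m∸n+n≡m k+l≤1+m)

proposition2p4 : ∀ (n k l : ℕ) → 1 ≤ n → k + l < n →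
    (n + k) * B₃ n k l ≡ ((n + k) C k) * ((n + l ∸ 1) C l) * (n ∸ k ∸ l)
proposition2p4 (suc m) k l _ (s≤s k+l≤m) = *-cancelˡ-≡ _ _ (suc m) (begin
  suc m * ((suc m + k) * B₃' m k l)
    ≡⟨ swap (suc m) (suc m + k) (B₃' m k l) ⟩
  (suc m + k) * (suc m * B₃' m k l)
    ≡⟨ cong ((suc m + k) *_) ([1+m]*B₃'≡[1+m-k-l]*C⁺*C⁺ m (m≤n⇒m≤1+n k+l≤m)) ⟩
  (suc m + k) * (c * (C⁺ m k * C⁺ m l))
    ≡⟨ reorder (suc m + k) c (C⁺ m k) (C⁺ m l) ⟩
  (suc m + k) * C⁺ m k * C⁺ m l * c
    ≡⟨ cong (λ x → x * C⁺ m l * c) ([1+m]*C⁺[1+m,k]≡[1+m+k]*C⁺[m,k] m k) ⟨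
  suc m * C⁺ (suc m) k * C⁺ m l * c
    ≡⟨ reassociate (suc m) (C⁺ (suc m) k) (C⁺ m l) c ⟩
  suc m * (C⁺ (suc m) k * C⁺ m l * c)
    ∎)
  where
  c = suc m ∸ k ∸ l
  swap : ∀ x y z → x * (y * z) ≡ y * (x * z)
  swap = solve-∀
  reorder : ∀ s c a b → s * (c * (a * b)) ≡ s * a * b * c
  reorder = solve-∀
  reassociate : ∀ s a b c → s * a * b * c ≡ s * (a * b * c)
  reassociate = solve-∀
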